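{- For all positive integers $n$ and $k$, \[ C_b(n,k) = C(n,\widehat k) + \sum_{j \geq 0} E_1(n-jk,k). \]
   Context: A composition of $N$ is a finite sequence of positive integers summing to $N$. $C_b(n,k)$ is the number of compositions of $n$ in which all parts equal to $k$ (if any) occur consecutively. $C(n,\widehat k)$ is the number of compositions of $n$ with no part equal to $k$. $E_1(N,k)$ is the number of compositions of $N$ having exactly one part equal to $k$ (and $0$ if $N<0$). -}

module Defs where

open import Data.Nat using (ℕ; zero; suc; _+_; _*_; _∸_; _≤ᵇ_; _≡ᵇ_)
open import Data.Bool using (Bool; true; false; if_then_else_; not; _∧_)
open import Data.List using (List; []; _∷_; map; concatMap; filter; length; sum; upTo; all; applyUpTo)
open import Data.List.Relation.Unary.All using (All)
open import Relation.Binary.PropositionalEquality using (_≡_)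
open import Relation.Nullary.Decidable using (Dec)
open import Relation.Unary using (Decidable)
open import Data.Bool using (T)

-- Defined with fuel to make termination structural.
compsFuel : ℕ → ℕ → List (List ℕ)
compsFuel zero    zero    = [] ∷ []
compsFuel zero    (suc _) = []
compsFuel (suc f) zero    = [] ∷ []
compsFuel (suc f) (suc m) =
  concatMap (λ i → map (λ c → suc i ∷ c) (compsFuel f (m ∸ i))) (upTo (suc m))

compositions : ℕ → List (List ℕ)
compositions n = compsFuel n n

countK : ℕ → List ℕ → ℕ
countK k []       = 0
countK k (x ∷ xs) = if x ≡ᵇ k then suc (countK k xs) else countK k xs

runsK : ℕ → List ℕ → ℕ
runsK k []       = 0
runsK k (x ∷ [])  = if x ≡ᵇ k then 1 else 0
runsK k (x ∷ y ∷ xs) =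
  if (x ≡ᵇ k) ∧ not (y ≡ᵇ k) then suc (runsK k (y ∷ xs)) else runsK k (y ∷ xs)

consecutiveK : ℕ → List ℕ → Bool
consecutiveK k c = runsK k c ≤ᵇ 1

countWhere : (List ℕ → Bool) → List (List ℕ) → ℕ
countWhere p []       = 0
countWhere p (c ∷ cs) = if p c then suc (countWhere p cs) else countWhere p cs

Cb : ℕ → ℕ → ℕ
Cb n k = countWhere (consecutiveK k) (compositions n)

Chat : ℕ → ℕ → ℕ
Chat n k = countWhere (λ c → countK k c ≡ᵇ 0) (compositions n)

E1 : ℕ → ℕ → ℕ
E1 N k = countWhere (λ c → countK k c ≡ᵇ 1) (compositions N)

-- the term E_1(n - j k, k), which is 0 when n - j k < 0
E1shift : ℕ → ℕ → ℕ → ℕ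
E1shift n k j = if (j * k) ≤ᵇ n then E1 (n ∸ j * k) k else 0

sumTo : ℕ → (ℕ → ℕ) → ℕ
sumTo zero    f = f 0
sumTo (suc m) f = sumTo m f + f (suc m)

module Submission where

-- Fix the distinguished part size K = suc k and classify
-- compositions of n by their first part i + 1.  Every count below then
-- satisfies a linear recurrence built from two operators on sequences:
--
--   transfer f n = Σ_{i<n, i≠k} f (n - 1 - i)   (first part different from K)
--   shift K f n  = f (n - K) if K ≤ n, else 0    (first part equal to K).
--
-- Write Z = C(·,k̂), O = E₁(·,K), C = C_b(·,K), S n = Σ_j E₁(n - jK, K),
-- and let D n count the compositions c of n such that K ∷ c still has its
-- K's consecutive (c begins with a possibly empty block of K's and has no
-- other K).  The first-part decomposition gives, for n ≥ 1,
--
--   Z = transfer Z,   O = transfer O + shift K Z,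
--   C = transfer C + shift K D,   D = transfer Z + shift K D,
--
-- and the definition of S gives S = O + shift K S for all n.  As transfer
-- is additive and commutes with shift K, strong induction yields
-- S = transfer S + shift K D; a second strong induction then shows that
-- C and Z + S satisfy the same recurrence, which is the theorem C = Z + S.

open import Defs
open import Data.Nat using (ℕ; suc; _+_)
open import Relation.Binary.PropositionalEquality using (_≡_)

open import Data.Nat using (zero; _*_; _∸_; _≤_; _<_; s≤s; _≤ᵇ_; _<ᵇ_; _≡ᵇ_; _≤?_; _<?_)
open import Data.Nat.Properties
open import Data.Nat.Induction using (<-rec)
open import Algebra.Properties.CommutativeSemigroup +-commutativeSemigroup using (interchange)
open import Data.Bool using (Bool; true; false; if_then_else_; T)
open import Data.Bool.Properties using (T-≡)
open import Data.Empty using (⊥-elim)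
open import Data.List using (List; []; _∷_; map; concatMap; upTo; applyUpTo; _++_)
open import Data.Nat.ListAction using (sum)
open import Function using (_∘_; Equivalence)
open import Relation.Nullary using (yes; no; ¬_)
open import Relation.Binary.Definitions using (tri<; tri≈; tri>)
open import Relation.Binary.PropositionalEquality
  using (refl; sym; trans; cong; cong₂; subst; module ≡-Reasoning)

sum< : (ℕ → ℕ) → ℕ → ℕ
sum< g zero    = 0
sum< g (suc n) = sum< g n + g n

sum<-cong : ∀ {g h} n → (∀ i → i < n → g i ≡ h i) → sum< g n ≡ sum< h n
sum<-cong zero    g≡h = refl
sum<-cong (suc n) g≡h =
  cong₂ _+_ (sum<-cong n (λ i i<n → g≡h i (m≤n⇒m≤1+n i<n))) (g≡h n ≤-refl)

sum<-ext : ∀ {g h} n → (∀ i → g i ≡ h i) → sum< g n ≡ sum< h n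
sum<-ext n g≡h = sum<-cong n (λ i _ → g≡h i)

sum<-+ : ∀ g h n → sum< (λ i → g i + h i) n ≡ sum< g n + sum< h n
sum<-+ g h zero    = refl
sum<-+ g h (suc n) =
  trans (cong (_+ (g n + h n)) (sum<-+ g h n))
        (interchange (sum< g n) (sum< h n) (g n) (h n))

sum<-zero : ∀ g n → (∀ i → g i ≡ 0) → sum< g n ≡ 0
sum<-zero g zero    g≡0 = refl
sum<-zero g (suc n) g≡0 rewrite sum<-zero g n g≡0 | g≡0 n = refl

sum<-split : ∀ g a b → sum< g (a + b) ≡ sum< g a + sum< (λ i → g (a + i)) b
sum<-split g a zero    rewrite +-identityʳ a = sym (+-identityʳ _)
sum<-split g a (suc b) rewrite +-suc a b | sum<-split g a b =
  +-assoc (sum< g a) (sum< (λ i → g (a + i)) b) (g (a + b))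

sum<-front : ∀ h n → sum< h (suc n) ≡ h 0 + sum< (h ∘ suc) n
sum<-front h zero    = +-comm 0 (h 0)
sum<-front h (suc n) rewrite sum<-front h n =
  +-assoc (h 0) (sum< (h ∘ suc) n) (h (suc n))

sum-map-applyUpTo : ∀ (g f : ℕ → ℕ) n → sum (map g (applyUpTo f n)) ≡ sum< (g ∘ f) n
sum-map-applyUpTo g f zero    = refl
sum-map-applyUpTo g f (suc n) rewrite sum-map-applyUpTo g (f ∘ suc) n =
  sym (sum<-front (g ∘ f) n)

≡ᵇ-refl : ∀ m → (m ≡ᵇ m) ≡ true
≡ᵇ-refl m = Equivalence.to T-≡ (≡⇒≡ᵇ m m refl)

≢⇒≡ᵇ-false : ∀ m n → ¬ m ≡ n → (m ≡ᵇ n) ≡ false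
≢⇒≡ᵇ-false m n m≢n with m ≡ᵇ n in eq
... | true  = ⊥-elim (m≢n (≡ᵇ⇒≡ m n (subst T (sym eq) _)))
... | false = refl

module _ (j : ℕ) (a : ℕ → ℕ) where

  private
    single : ℕ → ℕ
    single i = if i ≡ᵇ j then a i else 0

  sum<-single-≤ : ∀ n → n ≤ j → sum< single n ≡ 0
  sum<-single-≤ zero    _   = refl
  sum<-single-≤ (suc n) n<j
    rewrite sum<-single-≤ n (<⇒≤ n<j) | ≢⇒≡ᵇ-false n j (<⇒≢ n<j) = refl

  sum<-single-> : ∀ n → j < n → sum< single n ≡ a j
  sum<-single-> (suc n) (s≤s j≤n) with <-cmp j n
  ... | tri< j<n _ _
    rewrite sum<-single-> n j<n | ≢⇒≡ᵇ-false n j (λ n≡j → <⇒≢ j<n (sym n≡j)) = +-identityʳ (a j)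
  ... | tri≈ _ refl _ rewrite sum<-single-≤ n ≤-refl | ≡ᵇ-refl n = refl
  ... | tri> _ _ j>n = ⊥-elim (<⇒≱ j>n j≤n)

countWhere-++ : ∀ p xs ys → countWhere p (xs ++ ys) ≡ countWhere p xs + countWhere p ys
countWhere-++ p []       ys = refl
countWhere-++ p (x ∷ xs) ys with p x
... | true  = cong suc (countWhere-++ p xs ys)
... | false = countWhere-++ p xs ys

countWhere-concatMap : ∀ {A : Set} p (F : A → List (List ℕ)) xs →
  countWhere p (concatMap F xs) ≡ sum (map (λ x → countWhere p (F x)) xs)
countWhere-concatMap p F []       = refl
countWhere-concatMap p F (x ∷ xs) =
  trans (countWhere-++ p (F x) (concatMap F xs))
        (cong (countWhere p (F x) +_) (countWhere-concatMap p F xs))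

countWhere-cons : ∀ p a cs → countWhere p (map (a ∷_) cs) ≡ countWhere (p ∘ (a ∷_)) cs
countWhere-cons p a []       = refl
countWhere-cons p a (c ∷ cs) with p (a ∷ c)
... | true  = cong suc (countWhere-cons p a cs)
... | false = countWhere-cons p a cs

countWhere-cong : ∀ {p q} cs → (∀ c → p c ≡ q c) → countWhere p cs ≡ countWhere q cs
countWhere-cong []       p≡q = refl
countWhere-cong {p} {q} (c ∷ cs) p≡q rewrite p≡q c with q c
... | true  = cong suc (countWhere-cong cs p≡q)
... | false = countWhere-cong cs p≡q

countWhere-false : ∀ cs → countWhere (λ _ → false) cs ≡ 0
countWhere-false []       = refl
countWhere-false (_ ∷ cs) = countWhere-false cs

concatMap-cong : ∀ {A B : Set} {F G : A → List B} xs → (∀ x → F x ≡ G x) →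
  concatMap F xs ≡ concatMap G xs
concatMap-cong []       F≡G = refl
concatMap-cong (x ∷ xs) F≡G = cong₂ _++_ (F≡G x) (concatMap-cong xs F≡G)

compsFuel-irrelevant : ∀ f g m → m ≤ f → m ≤ g → compsFuel f m ≡ compsFuel g m
compsFuel-irrelevant zero    zero    zero    _       _       = refl
compsFuel-irrelevant zero    (suc g) zero    _       _       = refl
compsFuel-irrelevant (suc f) zero    zero    _       _       = refl
compsFuel-irrelevant (suc f) (suc g) zero    _       _       = refl
compsFuel-irrelevant (suc f) (suc g) (suc m) (s≤s m≤f) (s≤s m≤g) =
  concatMap-cong (upTo (suc m)) λ i → cong (map (suc i ∷_))
    (compsFuel-irrelevant f g (m ∸ i) (≤-trans (m∸n≤m m i) m≤f) (≤-trans (m∸n≤m m i) m≤g))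

count : (List ℕ → Bool) → ℕ → ℕ
count p n = countWhere p (compositions n)

count-by-first-part : ∀ p m →
  count p (suc m) ≡ sum< (λ i → count (p ∘ (suc i ∷_)) (m ∸ i)) (suc m)
count-by-first-part p m = begin
  countWhere p (concatMap F (upTo (suc m)))
    ≡⟨ countWhere-concatMap p F (upTo (suc m)) ⟩
  sum (map (λ i → countWhere p (F i)) (upTo (suc m)))
    ≡⟨ sum-map-applyUpTo _ (λ i → i) (suc m) ⟩
  sum< (λ i → countWhere p (F i)) (suc m)
    ≡⟨ sum<-ext (suc m) tails ⟩
  sum< (λ i → count (p ∘ (suc i ∷_)) (m ∸ i)) (suc m) ∎
  where
  open ≡-Reasoning
  F : ℕ → List (List ℕ)
  F i = map (suc i ∷_) (compsFuel m (m ∸ i))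
  tails : ∀ i → countWhere p (F i) ≡ count (p ∘ (suc i ∷_)) (m ∸ i)
  tails i = trans (countWhere-cons p (suc i) (compsFuel m (m ∸ i)))
    (cong (countWhere (p ∘ (suc i ∷_))) (compsFuel-irrelevant m (m ∸ i) (m ∸ i) (m∸n≤m m i) ≤-refl))

noRun⇔noPart : ∀ K c → (runsK K c ≡ᵇ 0) ≡ (countK K c ≡ᵇ 0)
noRun⇔noPart K []           = refl
noRun⇔noPart K (x ∷ [])     with x ≡ᵇ K
... | true  = refl
... | false = refl
noRun⇔noPart K (x ∷ y ∷ ys) with x ≡ᵇ K | y ≡ᵇ K | noRun⇔noPart K (y ∷ ys)
... | false | _     | ih = ih
... | true  | false | _  = refl
... | true  | true  | ih = ih

runsK-cons-≢ : ∀ K x c → (x ≡ᵇ K) ≡ false → runsK K (x ∷ c) ≡ runsK K c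
runsK-cons-≢ K x []       x≢K rewrite x≢K = refl
runsK-cons-≢ K x (y ∷ ys) x≢K rewrite x≢K = refl

shift : ℕ → (ℕ → ℕ) → ℕ → ℕ
shift zero    f n       = f n
shift (suc K) f zero    = 0
shift (suc K) f (suc n) = shift K f n

shift-≥ : ∀ K f n → K ≤ n → shift K f n ≡ f (n ∸ K)
shift-≥ zero    f n       _         = refl
shift-≥ (suc K) f (suc n) (s≤s K≤n) = shift-≥ K f n K≤n

shift-< : ∀ K f n → n < K → shift K f n ≡ 0
shift-< (suc K) f zero    _         = refl
shift-< (suc K) f (suc n) (s≤s n<K) = shift-< K f n n<K

shift-offset : ∀ K f m → shift K f (m + K) ≡ f m
shift-offset K f m = trans (shift-≥ K f (m + K) (m≤n+m K m)) (cong f (m+n∸n≡m m K))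

shift-+ : ∀ K f g n → shift K (λ x → f x + g x) n ≡ shift K f n + shift K g n
shift-+ zero    f g n       = refl
shift-+ (suc K) f g zero    = refl
shift-+ (suc K) f g (suc n) = shift-+ K f g n

shift-cong : ∀ K f g n → f (n ∸ K) ≡ g (n ∸ K) → shift K f n ≡ shift K g n
shift-cong zero    f g n       f≡g = f≡g
shift-cong (suc K) f g zero    _   = refl
shift-cong (suc K) f g (suc n) f≡g = shift-cong K f g n f≡g

<ᵇ1≡≡ᵇ0 : ∀ r → (r <ᵇ 1) ≡ (r ≡ᵇ 0)
<ᵇ1≡≡ᵇ0 zero    = refl
<ᵇ1≡≡ᵇ0 (suc r) = refl

if-0-+ : ∀ b x y → (if b then 0 else x + y) ≡ (if b then 0 else x) + (if b then 0 else y)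
if-0-+ true  x y = refl
if-0-+ false x y = refl

if-split : ∀ b x y → (if b then x else y) ≡ (if b then 0 else y) + (if b then x else 0)
if-split true  x y = refl
if-split false x y = sym (+-identityʳ y)

countWhere-if : ∀ b p q cs →
  countWhere (λ c → if b then p c else q c) cs ≡ (if b then countWhere p cs else countWhere q cs)
countWhere-if true  p q cs = refl
countWhere-if false p q cs = refl

sumTo-front : ∀ M f → sumTo (suc M) f ≡ f 0 + sumTo M (f ∘ suc)
sumTo-front zero    f = refl
sumTo-front (suc M) f rewrite sumTo-front M f =
  +-assoc (f 0) (sumTo M (f ∘ suc)) (f (suc (suc M)))

sumTo-ext : ∀ M {f g : ℕ → ℕ} → (∀ j → f j ≡ g j) → sumTo M f ≡ sumTo M g
sumTo-ext zero    f≡g = f≡g 0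
sumTo-ext (suc M) f≡g = cong₂ _+_ (sumTo-ext M f≡g) (f≡g (suc M))

sumTo-zero : ∀ M f → (∀ j → f j ≡ 0) → sumTo M f ≡ 0
sumTo-zero zero    f f≡0 = f≡0 0
sumTo-zero (suc M) f f≡0 rewrite sumTo-zero M f f≡0 | f≡0 (suc M) = refl

sumTo-vanishing-tail : ∀ M f → (∀ j → M < j → f j ≡ 0) → ∀ d → sumTo (M + d) f ≡ sumTo M f
sumTo-vanishing-tail M f tail≡0 zero    rewrite +-identityʳ M = refl
sumTo-vanishing-tail M f tail≡0 (suc d)
  rewrite +-suc M d | sumTo-vanishing-tail M f tail≡0 d
        | tail≡0 (suc (M + d)) (s≤s (m≤m+n M d)) = +-identityʳ _

E1shift-≤ : ∀ N K j → j * K ≤ N → E1shift N K j ≡ E1 (N ∸ j * K) K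
E1shift-≤ N K j jK≤N with j * K ≤ᵇ N | ≤⇒≤ᵇ jK≤N
... | true  | _  = refl
... | false | ()

E1shift-> : ∀ N K j → N < j * K → E1shift N K j ≡ 0
E1shift-> N K j N<jK with j * K ≤ᵇ N | ≤ᵇ⇒≤ (j * K) N
... | true  | jK≤N = ⊥-elim (<⇒≱ N<jK (jK≤N _))
... | false | _    = refl

E1shift-suc : ∀ N K j → K ≤ N → E1shift N K (suc j) ≡ E1shift (N ∸ K) K j
E1shift-suc N K j K≤N with j * K ≤? N ∸ K
... | yes jK≤N∸K = begin
  E1shift N K (suc j)      ≡⟨ E1shift-≤ N K (suc j) (subst (K + j * K ≤_) (m+[n∸m]≡n K≤N)
                                                           (+-monoʳ-≤ K jK≤N∸K)) ⟩
  E1 (N ∸ (K + j * K)) K   ≡⟨ cong (λ r → E1 r K) (sym (∸-+-assoc N K (j * K))) ⟩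
  E1 (N ∸ K ∸ j * K) K     ≡⟨ sym (E1shift-≤ (N ∸ K) K j jK≤N∸K) ⟩
  E1shift (N ∸ K) K j      ∎
  where open ≡-Reasoning
... | no jK≰N∸K = trans
  (E1shift-> N K (suc j) (subst (_< K + j * K) (m+[n∸m]≡n K≤N) (+-monoʳ-< K (≰⇒> jK≰N∸K))))
  (sym (E1shift-> (N ∸ K) K j (≰⇒> jK≰N∸K)))

module FixedPart (k : ℕ) where

  K : ℕ
  K = suc k

  -- Does the first part i + 1 equal K?
  isK : ℕ → Bool
  isK i = i ≡ᵇ k

  transfer : (ℕ → ℕ) → ℕ → ℕ
  transfer f n = sum< (λ i → if isK i then 0 else f (n ∸ suc i)) n

  transfer-cong : ∀ f g n → (∀ x → x < n → f x ≡ g x) → transfer f n ≡ transfer g n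
  transfer-cong f g zero    _   = refl
  transfer-cong f g (suc m) f≡g = sum<-ext (suc m) λ i →
    cong (if_then_else_ (isK i) 0) (f≡g (m ∸ i) (s≤s (m∸n≤m m i)))

  transfer-+ : ∀ f g n → transfer (λ x → f x + g x) n ≡ transfer f n + transfer g n
  transfer-+ f g n =
    trans (sum<-ext n (λ i → if-0-+ (isK i) (f (n ∸ suc i)) (g (n ∸ suc i)))) (sum<-+ _ _ n)

  first-part-sum : ∀ m (X Y : ℕ → ℕ) →
    sum< (λ i → if isK i then X (m ∸ i) else Y (m ∸ i)) (suc m)
      ≡ transfer Y (suc m) + shift K X (suc m)
  first-part-sum m X Y = begin
    sum< (λ i → if isK i then X (m ∸ i) else Y (m ∸ i)) n
      ≡⟨ sum<-ext n (λ i → if-split (isK i) (X (m ∸ i)) (Y (m ∸ i))) ⟩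
    sum< (λ i → (if isK i then 0 else Y (m ∸ i)) + (if isK i then X (m ∸ i) else 0)) n
      ≡⟨ sum<-+ _ _ n ⟩
    transfer Y n + sum< (λ i → if isK i then X (m ∸ i) else 0) n
      ≡⟨ cong (transfer Y n +_) partK ⟩
    transfer Y n + shift K X n ∎
    where
    open ≡-Reasoning
    n : ℕ
    n = suc m
    partK : sum< (λ i → if isK i then X (m ∸ i) else 0) n ≡ shift K X n
    partK with k <? n
    ... | yes k<n = trans (sum<-single-> k (λ i → X (m ∸ i)) n k<n) (sym (shift-≥ K X n k<n))
    ... | no  k≮n = trans (sum<-single-≤ k (λ i → X (m ∸ i)) n (≮⇒≥ k≮n))
                          (sym (shift-< K X n (s≤s (≮⇒≥ k≮n))))

  transfer-shift-offset : ∀ f m → transfer (shift K f) (m + K) ≡ transfer f m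
  transfer-shift-offset f m = begin
    sum< g (m + K)                       ≡⟨ sum<-split g m K ⟩
    sum< g m + sum< (λ i → g (m + i)) K  ≡⟨ cong₂ _+_ (sum<-cong m low) (sum<-zero _ K high) ⟩
    transfer f m + 0                     ≡⟨ +-identityʳ _ ⟩
    transfer f m                         ∎
    where
    open ≡-Reasoning
    g : ℕ → ℕ
    g i = if isK i then 0 else shift K f (m + K ∸ suc i)
    -- first parts i + 1 ≤ m leave a remainder of at least K
    low : ∀ i → i < m → g i ≡ (if isK i then 0 else f (m ∸ suc i))
    low i i<m = cong (if_then_else_ (isK i) 0)
      (trans (cong (shift K f) (+-∸-comm K i<m)) (shift-offset K f (m ∸ suc i)))
    -- larger first parts leave a remainder below K
    high : ∀ i → g (m + i) ≡ 0
    high i with isK (m + i)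
    ... | true  = refl
    ... | false = shift-< K f _ (subst (_< K) (sym remainder) (s≤s (m∸n≤m k i)))
      where
      remainder : m + K ∸ suc (m + i) ≡ k ∸ i
      remainder = trans (cong (m + K ∸_) (sym (+-suc m i))) ([m+n]∸[m+o]≡n∸o m K (suc i))

  transfer-shift : ∀ f n → transfer (shift K f) n ≡ shift K (transfer f) n
  transfer-shift f n with K ≤? n
  ... | yes K≤n = begin
    transfer (shift K f) n              ≡⟨ cong (transfer (shift K f)) (sym (m∸n+n≡m K≤n)) ⟩
    transfer (shift K f) (n ∸ K + K)    ≡⟨ transfer-shift-offset f (n ∸ K) ⟩
    transfer f (n ∸ K)                  ≡⟨ sym (shift-≥ K (transfer f) n K≤n) ⟩
    shift K (transfer f) n              ∎
    where open ≡-Reasoning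
  ... | no  K≰n = trans (sum<-zero _ n below) (sym (shift-< K (transfer f) n (≰⇒> K≰n)))
    where
    below : ∀ i → (if isK i then 0 else shift K f (n ∸ suc i)) ≡ 0
    below i with isK i
    ... | true  = refl
    ... | false = shift-< K f (n ∸ suc i) (≤-<-trans (m∸n≤m n (suc i)) (≰⇒> K≰n))

  none once block blockAfterK onceSum : ℕ → ℕ
  none        n = Chat n K
  once        n = E1 n K
  block       n = Cb n K
  blockAfterK n = count (λ c → consecutiveK K (K ∷ c)) n
  onceSum     n = sumTo n (E1shift n K)

  none-rec : ∀ m → none (suc m) ≡ transfer none (suc m)
  none-rec m = trans (count-by-first-part _ m) (sum<-ext (suc m) byFirst)
    where
    byFirst : ∀ i → count (λ c → countK K (suc i ∷ c) ≡ᵇ 0) (m ∸ i)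
                  ≡ (if isK i then 0 else none (m ∸ i))
    byFirst i with isK i
    ... | true  = countWhere-false (compositions (m ∸ i))
    ... | false = refl

  once-rec : ∀ m → once (suc m) ≡ transfer once (suc m) + shift K none (suc m)
  once-rec m = trans (count-by-first-part _ m)
                     (trans (sum<-ext (suc m) byFirst) (first-part-sum m none once))
    where
    byFirst : ∀ i → count (λ c → countK K (suc i ∷ c) ≡ᵇ 1) (m ∸ i)
                  ≡ (if isK i then none (m ∸ i) else once (m ∸ i))
    byFirst i with isK i
    ... | true  = refl
    ... | false = refl

  -- After a leading K, a further K continues the block; any other part
  -- ends it, after which no K may occur.
  blockAfterK-cons : ∀ i c → consecutiveK K (K ∷ suc i ∷ c)
                           ≡ (if isK i then consecutiveK K (K ∷ c) else countK K c ≡ᵇ 0)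
  blockAfterK-cons i c rewrite ≡ᵇ-refl k with isK i in i≡ᵇk
  ... | true  rewrite ≡ᵇ⇒≡ i k (subst T (sym i≡ᵇk) _) = refl
  ... | false rewrite runsK-cons-≢ K (suc i) c i≡ᵇk =
    trans (<ᵇ1≡≡ᵇ0 (runsK K c)) (noRun⇔noPart K c)

  -- A leading K starts the only allowed block; any other part is irrelevant.
  block-cons : ∀ i c → consecutiveK K (suc i ∷ c)
                     ≡ (if isK i then consecutiveK K (K ∷ c) else consecutiveK K c)
  block-cons i c with isK i in i≡ᵇk
  ... | true  rewrite ≡ᵇ⇒≡ i k (subst T (sym i≡ᵇk) _) = refl
  ... | false rewrite runsK-cons-≢ K (suc i) c i≡ᵇk = refl

  blockAfterK-rec : ∀ m → blockAfterK (suc m) ≡ transfer none (suc m) + shift K blockAfterK (suc m)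
  blockAfterK-rec m = trans (count-by-first-part _ m)
                            (trans (sum<-ext (suc m) byFirst) (first-part-sum m blockAfterK none))
    where
    byFirst : ∀ i → count (λ c → consecutiveK K (K ∷ suc i ∷ c)) (m ∸ i)
                  ≡ (if isK i then blockAfterK (m ∸ i) else none (m ∸ i))
    byFirst i = trans (countWhere-cong (compositions (m ∸ i)) (blockAfterK-cons i))
                      (countWhere-if (isK i) _ _ (compositions (m ∸ i)))

  block-rec : ∀ m → block (suc m) ≡ transfer block (suc m) + shift K blockAfterK (suc m)
  block-rec m = trans (count-by-first-part _ m)
                      (trans (sum<-ext (suc m) byFirst) (first-part-sum m blockAfterK block))
    where
    byFirst : ∀ i → count (λ c → consecutiveK K (suc i ∷ c)) (m ∸ i)
                  ≡ (if isK i then blockAfterK (m ∸ i) else block (m ∸ i))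
    byFirst i = trans (countWhere-cong (compositions (m ∸ i)) (block-cons i))
                      (countWhere-if (isK i) _ _ (compositions (m ∸ i)))

  -- D = Z + shift K D: either c has no K, or c begins with a K.
  blockAfterK-split : ∀ n → blockAfterK n ≡ none n + shift K blockAfterK n
  blockAfterK-split zero    rewrite ≡ᵇ-refl k = refl
  blockAfterK-split (suc m) =
    trans (blockAfterK-rec m) (cong (_+ shift K blockAfterK (suc m)) (sym (none-rec m)))

  -- S = O + shift K S: split off the term j = 0 and reindex the rest.
  onceSum-rec : ∀ n → onceSum n ≡ once n + shift K onceSum n
  onceSum-rec zero    = refl
  onceSum-rec (suc N) = trans (sumTo-front N (E1shift (suc N) K)) (cong (once (suc N) +_) rest)
    where
    rest : sumTo N (λ j → E1shift (suc N) K (suc j)) ≡ shift K onceSum (suc N)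
    rest with K ≤? suc N
    ... | no K≰n = trans
      (sumTo-zero N _ (λ j → E1shift-> (suc N) K (suc j) (<-≤-trans (≰⇒> K≰n) (m≤m+n K (j * K)))))
      (sym (shift-< K onceSum (suc N) (≰⇒> K≰n)))
    ... | yes K≤n = begin
      sumTo N (λ j → E1shift (suc N) K (suc j))   ≡⟨ sumTo-ext N (λ j → E1shift-suc (suc N) K j K≤n) ⟩
      sumTo N (E1shift r K)                        ≡⟨ cong (λ M → sumTo M (E1shift r K)) (sym (m+[n∸m]≡n r≤N)) ⟩
      sumTo (r + (N ∸ r)) (E1shift r K)            ≡⟨ sumTo-vanishing-tail r (E1shift r K) beyond (N ∸ r) ⟩
      onceSum r                                    ≡⟨ sym (shift-≥ K onceSum (suc N) K≤n) ⟩
      shift K onceSum (suc N)                      ∎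
      where
      open ≡-Reasoning
      r : ℕ
      r = suc N ∸ K
      r≤N : r ≤ N
      r≤N = m∸n≤m N k
      beyond : ∀ j → r < j → E1shift r K j ≡ 0
      beyond j r<j = E1shift-> r K j (<-≤-trans r<j (m≤m*n j K))

  -- S = transfer S + shift K D, by strong induction using S = O + shift K S,
  -- the recurrence of O, and D = Z + shift K D.
  onceSum-transfer : ∀ n → onceSum n ≡ transfer onceSum n + shift K blockAfterK n
  onceSum-transfer = <-rec _ step
    where
    step : ∀ n → (∀ {m} → m < n → onceSum m ≡ transfer onceSum m + shift K blockAfterK m) →
           onceSum n ≡ transfer onceSum n + shift K blockAfterK n
    step zero    _  = refl
    step (suc m) ih = begin
      onceSum n
        ≡⟨ onceSum-rec n ⟩
      once n + shift K onceSum n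
        ≡⟨ cong₂ _+_ (once-rec m) shiftedS ⟩
      (transfer once n + shift K none n) + (shift K (transfer onceSum) n + shift K (shift K blockAfterK) n)
        ≡⟨ interchange (transfer once n) (shift K none n) _ _ ⟩
      (transfer once n + shift K (transfer onceSum) n) + (shift K none n + shift K (shift K blockAfterK) n)
        ≡⟨ cong₂ _+_ (sym transferS) (sym shiftedD) ⟩
      transfer onceSum n + shift K blockAfterK n ∎
      where
      open ≡-Reasoning
      n : ℕ
      n = suc m
      shiftedS : shift K onceSum n ≡ shift K (transfer onceSum) n + shift K (shift K blockAfterK) n
      shiftedS = trans (shift-cong K onceSum _ n (ih (s≤s (m∸n≤m m k))))
                       (shift-+ K (transfer onceSum) (shift K blockAfterK) n)
      transferS : transfer onceSum n ≡ transfer once n + shift K (transfer onceSum) n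
      transferS = trans (transfer-cong onceSum _ n (λ x _ → onceSum-rec x))
        (trans (transfer-+ once (shift K onceSum) n) (cong (transfer once n +_) (transfer-shift onceSum n)))
      shiftedD : shift K blockAfterK n ≡ shift K none n + shift K (shift K blockAfterK) n
      shiftedD = trans (shift-cong K blockAfterK _ n (blockAfterK-split (n ∸ K)))
                       (shift-+ K none (shift K blockAfterK) n)

  -- C = Z + S, by strong induction: both sides satisfy X = transfer X + shift K D.
  block≡none+onceSum : ∀ n → block n ≡ none n + onceSum n
  block≡none+onceSum = <-rec _ step
    where
    step : ∀ n → (∀ {m} → m < n → block m ≡ none m + onceSum m) → block n ≡ none n + onceSum n
    step zero    _  = refl
    step (suc m) ih = begin
      block n
        ≡⟨ block-rec m ⟩
      transfer block n + shift K blockAfterK n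
        ≡⟨ cong (_+ shift K blockAfterK n) (transfer-cong block _ n (λ x x<n → ih x<n)) ⟩
      transfer (λ x → none x + onceSum x) n + shift K blockAfterK n
        ≡⟨ cong (_+ shift K blockAfterK n) (transfer-+ none onceSum n) ⟩
      (transfer none n + transfer onceSum n) + shift K blockAfterK n
        ≡⟨ +-assoc (transfer none n) (transfer onceSum n) (shift K blockAfterK n) ⟩
      transfer none n + (transfer onceSum n + shift K blockAfterK n)
        ≡⟨ cong₂ _+_ (sym (none-rec m)) (sym (onceSum-transfer n)) ⟩
      none n + onceSum n ∎
      where
      open ≡-Reasoning
      n : ℕ
      n = suc m

-- C_b(n,k) = C(n,k̂) + Σ_{j≥0} E₁(n - jk, k) for positive n and k; the
-- statement truncates the sum at j = n, exactly as onceSum does.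
mainTheorem17 : (n k : ℕ) →
    Cb (suc n) (suc k) ≡ Chat (suc n) (suc k) + sumTo (suc n) (E1shift (suc n) (suc k))
mainTheorem17 n k = FixedPart.block≡none+onceSum k (suc n)
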